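{- Let $G_1\trianglelefteq G_2$ be groups with $C_{G_2}(G_1)=\{e\}$, and let $A\subseteq G_1$ be such that $(G_1,A)$ is a special pair. Then $(G_2,A)$ is a special pair.
   Context: For a group $G$, $A\subseteq G$ and $x\in G$, $tp_{qf}(x,A,G)$ is the set of group words $\sigma(z,\bar a)$ in one variable $z$ with parameters $\bar a$ from $A$ such that $\sigma(x,\bar a)=e$ in $G$. The pair $(G,A)$ is special if $A\subseteq G$ and for all $x,y\in G$, $tp_{qf}(x,A,G)=tp_{qf}(y,A,G)$ implies $x=y$. $C_H(K)$ is the centralizer of $K$ in $H$. -}

module Defs where

open import Level using (Level; _⊔_)
open import Algebra.Bundles using (Group)
open import Algebra.Morphism.Structures using (module GroupMorphisms)
open import Data.Product using (Σ; ∃; _×_; proj₁)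
open import Function.Bundles using (_⇔_)
open import Relation.Unary using (Pred)

data Word {p : Level} (P : Set p) : Set p where
  var   : Word P
  param : P → Word P
  unit  : Word P
  _·_   : Word P → Word P → Word P
  inv   : Word P → Word P

module _ {c ℓ : Level} (G : Group c ℓ) where
  open Group G

  evalWord : {p : Level} {P : Set p} → (P → Carrier) → Word P → Carrier → Carrier
  evalWord ⟦_⟧ var       x = x
  evalWord ⟦_⟧ (param a) x = ⟦ a ⟧
  evalWord ⟦_⟧ unit      x = ε
  evalWord ⟦_⟧ (σ · τ)   x = evalWord ⟦_⟧ σ x ∙ evalWord ⟦_⟧ τ x
  evalWord ⟦_⟧ (inv σ)   x = evalWord ⟦_⟧ σ x ⁻¹

  Param : {a : Level} → Pred Carrier a → Set (c ⊔ a)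
  Param A = Σ Carrier A

  -- (G, A) is a special pair: equal qf-types imply equality
  Special : {a : Level} → Pred Carrier a → Set (c ⊔ ℓ ⊔ a)
  Special A = ∀ x y →
    (∀ (σ : Word (Param A)) → (evalWord proj₁ σ x ≈ ε) ⇔ (evalWord proj₁ σ y ≈ ε)) →
    x ≈ y

-- G₁ ⊴ G₂ is presented by an injective group homomorphism ι : G₁ → G₂
-- whose image is normal in G₂.
module _ {c₁ ℓ₁ c₂ ℓ₂ : Level} (G₁ : Group c₁ ℓ₁) (G₂ : Group c₂ ℓ₂) where
  private
    module G₁ = Group G₁
    module G₂ = Group G₂
  open GroupMorphisms G₁.rawGroup G₂.rawGroup using (IsGroupMonomorphism)

  record NormalEmbedding : Set (c₁ ⊔ ℓ₁ ⊔ c₂ ⊔ ℓ₂) where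
    field
      ι      : G₁.Carrier → G₂.Carrier
      isMono : IsGroupMonomorphism ι
      normal : ∀ (g : G₂.Carrier) (h : G₁.Carrier) →
               ∃ λ h′ → ι h′ G₂.≈ ((g G₂.∙ ι h) G₂.∙ (g G₂.⁻¹))

  TrivialCentralizer : NormalEmbedding → Set (c₁ ⊔ c₂ ⊔ ℓ₂)
  TrivialCentralizer N = ∀ (g : G₂.Carrier) →
    (∀ (h : G₁.Carrier) → (g G₂.∙ ι h) G₂.≈ (ι h G₂.∙ g)) → g G₂.≈ G₂.ε
    where open NormalEmbedding N

  image : {a : Level} → NormalEmbedding → Pred G₁.Carrier a → Pred G₂.Carrier (c₁ ⊔ ℓ₂ ⊔ a)
  image N A g = ∃ λ x → A x × (NormalEmbedding.ι N x G₂.≈ g)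

-- If x and y have the same type over A in G₂, then for a ∈ A the conjugates x a x⁻¹ and y a y⁻¹
-- lie in G₁ by normality and have the same type over A, since a word in them is a word in x resp. y
-- (substitute z a z⁻¹ for z).  So they are equal, and c = y⁻¹ x centralizes A.  Conjugation by c is
-- then an automorphism of G₂ fixing A, so each h ∈ G₁ has the same type over A as c h c⁻¹ ∈ G₁;
-- hence c centralizes G₁, so c = e and x = y.
module Submission where

open import Defs
open import Level using (Level; _⊔_)
open import Algebra.Bundles using (Group)
open import Algebra.Morphism.Structures using (module GroupMorphisms)
open import Relation.Unary using (Pred)
open import Data.Product using (_,_; proj₁; proj₂)
open import Function.Base using (_∘_)
open import Function.Bundles using (_⇔_; mk⇔)
import Function.Properties.Equivalence as ⇔
import Algebra.Properties.Group as GroupProperties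
import Algebra.Properties.Quasigroup as QuasigroupProperties
import Relation.Binary.Reasoning.Setoid as SetoidReasoning

private
  variable
    c c′ ℓ ℓ′ p q : Level
    P : Set p
    Q : Set q

substitute : Word Q → (P → Q) → Word P → Word Q
substitute s t var       = s
substitute s t (param a) = param (t a)
substitute s t unit      = unit
substitute s t (σ · τ)   = substitute s t σ · substitute s t τ
substitute s t (inv σ)   = inv (substitute s t σ)

module WordProperties (G : Group c ℓ) where
  open Group G

  SameQfType : {P : Set p} → (P → Carrier) → Carrier → Carrier → Set (p ⊔ ℓ)
  SameQfType f x y = ∀ σ → (evalWord G f σ x ≈ ε) ⇔ (evalWord G f σ y ≈ ε)

  evalWord-cong : {f g : P → Carrier} (σ : Word P) {x y : Carrier} →
                  (∀ a → f a ≈ g a) → x ≈ y → evalWord G f σ x ≈ evalWord G g σ y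
  evalWord-cong var       f≈g x≈y = x≈y
  evalWord-cong (param a) f≈g x≈y = f≈g a
  evalWord-cong unit      f≈g x≈y = refl
  evalWord-cong (σ · τ)   f≈g x≈y = ∙-cong (evalWord-cong σ f≈g x≈y) (evalWord-cong τ f≈g x≈y)
  evalWord-cong (inv σ)   f≈g x≈y = ⁻¹-cong (evalWord-cong σ f≈g x≈y)

  evalWord-substitute : (f : Q → Carrier) (s : Word Q) (t : P → Q) (σ : Word P) (x : Carrier) →
                        evalWord G f (substitute s t σ) x ≈ evalWord G (f ∘ t) σ (evalWord G f s x)
  evalWord-substitute f s t var       x = refl
  evalWord-substitute f s t (param a) x = refl
  evalWord-substitute f s t unit      x = refl
  evalWord-substitute f s t (σ · τ)   x =
    ∙-cong (evalWord-substitute f s t σ x) (evalWord-substitute f s t τ x)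
  evalWord-substitute f s t (inv σ)   x = ⁻¹-cong (evalWord-substitute f s t σ x)

  ≈ε-resp : ∀ {u v} → u ≈ v → (u ≈ ε) ⇔ (v ≈ ε)
  ≈ε-resp u≈v = mk⇔ (trans (sym u≈v)) (trans u≈v)

  sameQfType-resp : {f : P → Carrier} {x x′ y y′ : Carrier} → x ≈ x′ → y ≈ y′ →
                    SameQfType f x y → SameQfType f x′ y′
  sameQfType-resp x≈x′ y≈y′ x≡ₜy σ =
    ⇔.trans (≈ε-resp (evalWord-cong σ (λ _ → refl) (sym x≈x′)))
      (⇔.trans (x≡ₜy σ) (≈ε-resp (evalWord-cong σ (λ _ → refl) y≈y′)))

  sameQfType-substitute : (f : Q → Carrier) (s : Word Q) (t : P → Q) {x y : Carrier} →
                          SameQfType f x y →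
                          SameQfType (f ∘ t) (evalWord G f s x) (evalWord G f s y)
  sameQfType-substitute f s t x≡ₜy σ =
    ⇔.trans (≈ε-resp (sym (evalWord-substitute f s t σ _)))
      (⇔.trans (x≡ₜy (substitute s t σ)) (≈ε-resp (evalWord-substitute f s t σ _)))

module Conjugation (G : Group c ℓ) where
  open Group G
  open GroupProperties G using (quasigroup; ⁻¹-anti-homo-∙; ⁻¹-involutive; ε⁻¹≈ε)
  open QuasigroupProperties quasigroup using (cancelˡ; cancelʳ)
  open GroupMorphisms rawGroup rawGroup using (IsGroupMonomorphism)
  open SetoidReasoning setoid

  conj : Carrier → Carrier → Carrier
  conj g u = g ∙ u ∙ g ⁻¹

  conj-cong : ∀ g {u v} → u ≈ v → conj g u ≈ conj g v
  conj-cong g u≈v = ∙-congʳ (∙-congˡ u≈v)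

  conj-homo : ∀ g u v → conj g (u ∙ v) ≈ conj g u ∙ conj g v
  conj-homo g u v = sym (begin
    (g ∙ u ∙ g ⁻¹) ∙ (g ∙ v ∙ g ⁻¹)   ≈⟨ assoc _ _ _ ⟩
    g ∙ u ∙ (g ⁻¹ ∙ (g ∙ v ∙ g ⁻¹))   ≈⟨ ∙-congˡ (sym (assoc _ _ _)) ⟩
    g ∙ u ∙ (g ⁻¹ ∙ (g ∙ v) ∙ g ⁻¹)   ≈⟨ ∙-congˡ (∙-congʳ (sym (assoc _ _ _))) ⟩
    g ∙ u ∙ (g ⁻¹ ∙ g ∙ v ∙ g ⁻¹)     ≈⟨ ∙-congˡ (∙-congʳ (∙-congʳ (inverseˡ g))) ⟩
    g ∙ u ∙ (ε ∙ v ∙ g ⁻¹)            ≈⟨ ∙-congˡ (∙-congʳ (identityˡ v)) ⟩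
    g ∙ u ∙ (v ∙ g ⁻¹)                ≈⟨ sym (assoc _ _ _) ⟩
    g ∙ u ∙ v ∙ g ⁻¹                  ≈⟨ ∙-congʳ (assoc _ _ _) ⟩
    conj g (u ∙ v)                    ∎)

  conj-ε : ∀ g → conj g ε ≈ ε
  conj-ε g = trans (∙-congʳ (identityʳ g)) (inverseʳ g)

  conj-⁻¹ : ∀ g u → conj g (u ⁻¹) ≈ conj g u ⁻¹
  conj-⁻¹ g u = sym (begin
    (g ∙ u ∙ g ⁻¹) ⁻¹           ≈⟨ ⁻¹-anti-homo-∙ _ _ ⟩
    g ⁻¹ ⁻¹ ∙ (g ∙ u) ⁻¹        ≈⟨ ∙-cong (⁻¹-involutive g) (⁻¹-anti-homo-∙ _ _) ⟩
    g ∙ (u ⁻¹ ∙ g ⁻¹)           ≈⟨ sym (assoc _ _ _) ⟩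
    conj g (u ⁻¹)               ∎)

  conj-injective : ∀ g {u v} → conj g u ≈ conj g v → u ≈ v
  conj-injective g eq = cancelˡ g _ _ (cancelʳ (g ⁻¹) _ _ eq)

  conj-isGroupMonomorphism : ∀ g → IsGroupMonomorphism (conj g)
  conj-isGroupMonomorphism g = record
    { isGroupHomomorphism = record
      { isMonoidHomomorphism = record
        { isMagmaHomomorphism = record
          { isRelHomomorphism = record { cong = conj-cong g }
          ; homo              = conj-homo g
          }
        ; ε-homo = conj-ε g
        }
      ; ⁻¹-homo = conj-⁻¹ g
      }
    ; injective = conj-injective g
    }

  conj-∙ : ∀ g h u → conj (g ∙ h) u ≈ conj g (conj h u)
  conj-∙ g h u = begin
    g ∙ h ∙ u ∙ (g ∙ h) ⁻¹        ≈⟨ ∙-congˡ (⁻¹-anti-homo-∙ _ _) ⟩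
    g ∙ h ∙ u ∙ (h ⁻¹ ∙ g ⁻¹)     ≈⟨ sym (assoc _ _ _) ⟩
    g ∙ h ∙ u ∙ h ⁻¹ ∙ g ⁻¹       ≈⟨ ∙-congʳ (∙-congʳ (assoc _ _ _)) ⟩
    g ∙ (h ∙ u) ∙ h ⁻¹ ∙ g ⁻¹     ≈⟨ ∙-congʳ (assoc _ _ _) ⟩
    conj g (conj h u)             ∎

  conj-ε-left : ∀ u → conj ε u ≈ u
  conj-ε-left u = trans (∙-cong (identityˡ u) ε⁻¹≈ε) (identityʳ u)

  conj≈conj⇒conj-fixes : ∀ x y u → conj x u ≈ conj y u → conj (y ⁻¹ ∙ x) u ≈ u
  conj≈conj⇒conj-fixes x y u eq = begin
    conj (y ⁻¹ ∙ x) u        ≈⟨ conj-∙ _ _ _ ⟩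
    conj (y ⁻¹) (conj x u)   ≈⟨ conj-cong _ eq ⟩
    conj (y ⁻¹) (conj y u)   ≈⟨ conj-∙ _ _ _ ⟨
    conj (y ⁻¹ ∙ y) u        ≈⟨ ∙-cong (∙-congʳ (inverseˡ y)) (⁻¹-cong (inverseˡ y)) ⟩
    conj ε u                 ≈⟨ conj-ε-left u ⟩
    u                        ∎

  conj-fixes⇒commute : ∀ g u → conj g u ≈ u → g ∙ u ≈ u ∙ g
  conj-fixes⇒commute g u eq = begin
    g ∙ u                   ≈⟨ identityʳ _ ⟨
    g ∙ u ∙ ε               ≈⟨ ∙-congˡ (inverseˡ g) ⟨
    g ∙ u ∙ (g ⁻¹ ∙ g)      ≈⟨ assoc _ _ _ ⟨
    conj g u ∙ g            ≈⟨ ∙-congʳ eq ⟩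
    u ∙ g                   ∎

module HomomorphismProperties (G : Group c ℓ) (H : Group c′ ℓ′) where
  private
    module G = Group G
    module H = Group H
  open GroupMorphisms G.rawGroup H.rawGroup using (IsGroupHomomorphism; IsGroupMonomorphism)
  open WordProperties H using (≈ε-resp)
  open WordProperties using (SameQfType)

  evalWord-homo : {φ : G.Carrier → H.Carrier} → IsGroupHomomorphism φ →
                  (f : P → G.Carrier) (σ : Word P) (x : G.Carrier) →
                  φ (evalWord G f σ x) H.≈ evalWord H (φ ∘ f) σ (φ x)
  evalWord-homo hom f var       x = H.refl
  evalWord-homo hom f (param a) x = H.refl
  evalWord-homo hom f unit      x = IsGroupHomomorphism.ε-homo hom
  evalWord-homo hom f (σ · τ)   x = H.trans (IsGroupHomomorphism.homo hom _ _)
    (H.∙-cong (evalWord-homo hom f σ x) (evalWord-homo hom f τ x))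
  evalWord-homo hom f (inv σ)   x = H.trans (IsGroupHomomorphism.⁻¹-homo hom _)
    (H.⁻¹-cong (evalWord-homo hom f σ x))

  module _ {φ : G.Carrier → H.Carrier} (mono : IsGroupMonomorphism φ) where
    open IsGroupMonomorphism mono

    ≈ε⇔φ≈ε : ∀ u → (u G.≈ G.ε) ⇔ (φ u H.≈ H.ε)
    ≈ε⇔φ≈ε u = mk⇔ (λ u≈ε → H.trans (⟦⟧-cong u≈ε) ε-homo)
                   (λ φu≈ε → injective (H.trans φu≈ε (H.sym ε-homo)))

    evalWord≈ε-mono : (f : P → G.Carrier) (σ : Word P) (x : G.Carrier) →
                      (evalWord G f σ x G.≈ G.ε) ⇔ (evalWord H (φ ∘ f) σ (φ x) H.≈ H.ε)
    evalWord≈ε-mono f σ x =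
      ⇔.trans (≈ε⇔φ≈ε _) (≈ε-resp (evalWord-homo isGroupHomomorphism f σ x))

    sameQfType-reflect : {f : P → G.Carrier} {x y : G.Carrier} →
                         SameQfType H (φ ∘ f) (φ x) (φ y) → SameQfType G f x y
    sameQfType-reflect {f = f} {x} {y} φx≡ₜφy σ =
      ⇔.trans (evalWord≈ε-mono f σ x) (⇔.trans (φx≡ₜφy σ) (⇔.sym (evalWord≈ε-mono f σ y)))

sameQfType-fixed : (G : Group c ℓ) → let open Group G in
                   {φ : Carrier → Carrier} →
                   GroupMorphisms.IsGroupMonomorphism rawGroup rawGroup φ →
                   {f : P → Carrier} → (∀ a → φ (f a) ≈ f a) →
                   ∀ u → WordProperties.SameQfType G f (φ u) u
sameQfType-fixed G mono {f} φf≈f u σ =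
  ⇔.trans (≈ε-resp (evalWord-cong σ (λ a → sym (φf≈f a)) refl))
          (⇔.sym (evalWord≈ε-mono mono f σ u))
  where
  open Group G
  open WordProperties G
  open HomomorphismProperties G G

module NormalEmbeddingProperties (G₁ : Group c ℓ) (G₂ : Group c′ ℓ′) (N : NormalEmbedding G₁ G₂)
  {a : Level} (A : Pred (Group.Carrier G₁) a) (special : Special G₁ A) where
  open Group G₂
  open NormalEmbedding N
  open GroupMorphisms.IsGroupMonomorphism isMono using (⟦⟧-cong)
  open WordProperties G₂
  open Conjugation G₂
  open HomomorphismProperties G₁ G₂ using (sameQfType-reflect)

  ι-param : Param G₁ A → Param G₂ (image G₁ G₂ N A)
  ι-param p = ι (proj₁ p) , proj₁ p , proj₂ p , refl

  sameQfType⇒≈ : ∀ {h h′ u v} → ι h ≈ u → ι h′ ≈ v → SameQfType (ι ∘ proj₁) u v → u ≈ v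
  sameQfType⇒≈ {h} {h′} ιh≈u ιh′≈v u≡ₜv = trans (sym ιh≈u) (trans (⟦⟧-cong h≈h′) ιh′≈v)
    where
    h≈h′ : Group._≈_ G₁ h h′
    h≈h′ = special _ _ (sameQfType-reflect isMono (sameQfType-resp (sym ιh≈u) (sym ιh′≈v) u≡ₜv))

  conj-agree : ∀ {x y} → SameQfType proj₁ x y → ∀ {a} → A a → conj x (ι a) ≈ conj y (ι a)
  conj-agree {x} {y} x≡ₜy {a} Aa = sameQfType⇒≈ (proj₂ (normal x a)) (proj₂ (normal y a))
    (sameQfType-substitute proj₁ ((var · param (ι-param (a , Aa))) · inv var) ι-param x≡ₜy)

  conj-fixes⇒centralizes : ∀ g → (∀ {a} → A a → conj g (ι a) ≈ ι a) → ∀ h → g ∙ ι h ≈ ι h ∙ g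
  conj-fixes⇒centralizes g fixes h = conj-fixes⇒commute g (ι h)
    (sameQfType⇒≈ (proj₂ (normal g h)) refl
      (sameQfType-fixed G₂ (conj-isGroupMonomorphism g) (λ p → fixes (proj₂ p)) (ι h)))

claim3p8 : {c₁ ℓ₁ c₂ ℓ₂ a : Level} (G₁ : Group c₁ ℓ₁) (G₂ : Group c₂ ℓ₂)
           (N : NormalEmbedding G₁ G₂) → TrivialCentralizer G₁ G₂ N →
           (A : Pred (Group.Carrier G₁) a) → Special G₁ A →
           Special G₂ (image G₁ G₂ N A)
claim3p8 G₁ G₂ N trivial A special x y x≡ₜy =
  trans (inverseʳ-unique (y ⁻¹) x y⁻¹x≈ε) (⁻¹-involutive y)
  where
  open Group G₂
  open GroupProperties G₂ using (inverseʳ-unique; ⁻¹-involutive)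
  open Conjugation G₂ using (conj≈conj⇒conj-fixes)
  open NormalEmbeddingProperties G₁ G₂ N A special

  y⁻¹x≈ε : y ⁻¹ ∙ x ≈ ε
  y⁻¹x≈ε = trivial (y ⁻¹ ∙ x) (conj-fixes⇒centralizes (y ⁻¹ ∙ x)
    (λ Aa → conj≈conj⇒conj-fixes x y _ (conj-agree x≡ₜy Aa)))
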